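{- State reachability is decidable in $\mu$Stipula$^{\tt DI}$: there is an algorithm that, given a $\mu$Stipula$^{\tt DI}$ contract ${\tt C}$ and a state ${\tt Q}$, decides whether ${\tt Q}$ is reachable in ${\tt C}$.
   Context: A $\mu$Stipula contract ${\tt C}$ consists of a finite set of states, an initial state ${\tt Q}_{\rm init}$, and a finite set of functions $@{\tt Q}\; {\tt f}\,\{W\} \Rightarrow @{\tt Q}'$, where $W$ is a finite sequence of events ${\tt now}+k \gg @{\tt Q}_1 \Rightarrow @{\tt Q}_2$ (${\tt Q}_1$ is the event's initial state), each event occurrence carrying a unique line index $n$. A pending event is $k \gg_n {\tt Q}_1 \Rightarrow {\tt Q}_2$. A configuration is ${\tt C}({\tt Q},\Sigma,\Psi)$ with ${\tt Q}$ a state, $\Psi$ a finite multiset of pending events (written with $|$, empty $\_$), and $\Sigma$ either empty ($\_$) or $\Psi'\Rightarrow{\tt Q}'$. (A clock incremented by Tick is also carried; irrelevant here.) $\mathit{nored}(\Psi,{\tt Q})$ holds iff $\Psi$ has no pending event $0\gg_n {\tt Q}\Rightarrow {\tt Q}'$; $\Psi\!\downarrow$ deletes pending events with time $0$ and decrements all others. Transitions: (Function) if $@{\tt Q}\,{\tt f}\{W\}\Rightarrow@{\tt Q}'$ is in ${\tt C}$ and $\mathit{nored}(\Psi,{\tt Q})$, then ${\tt C}({\tt Q},\_,\Psi)\to{\tt C}({\tt Q},\Psi_W\Rightarrow{\tt Q}',\Psi)$, with $\Psi_W$ the multiset of $k\gg_n{\tt Q}_1\Rightarrow{\tt Q}_2$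 for the events of $W$; (State-Change) ${\tt C}({\tt Q},\Psi'\Rightarrow{\tt Q}',\Psi)\to{\tt C}({\tt Q}',\_,\Psi'|\Psi)$; (Event-Match) ${\tt C}({\tt Q},\_,0\gg_n{\tt Q}\Rightarrow{\tt Q}'\,|\,\Psi')\to{\tt C}({\tt Q},\_\Rightarrow{\tt Q}',\Psi')$; (Tick) if $\mathit{nored}(\Psi,{\tt Q})$ then ${\tt C}({\tt Q},\_,\Psi)\to{\tt C}({\tt Q},\_,\Psi\!\downarrow)$. A state ${\tt Q}$ is reachable in ${\tt C}$ iff ${\tt C}({\tt Q}_{\rm init},\_,\_)\to^*{\tt C}({\tt Q},\_,\Psi)$ for some $\Psi$. $\mu$Stipula$^{\tt DI}$ is the fragment of contracts in which every event has time expression ${\tt now}+0$ and no state is both the initial state of a function and the initial state of an event. -}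

module Defs where

open import Data.Nat using (ℕ; zero; suc)
open import Data.Fin using (Fin)
open import Data.List using (List; []; _∷_; _++_; map; concatMap)
open import Data.List.Membership.Propositional using (_∈_)
open import Data.List.Relation.Unary.All using (All)
open import Data.List.Relation.Unary.Unique.Propositional using (Unique)
open import Data.Maybe using (Maybe; just; nothing)
open import Data.Product using (_×_; _,_; ∃)
open import Relation.Binary.PropositionalEquality using (_≡_)
open import Relation.Binary.Construct.Closure.ReflexiveTransitive using (Star)
open import Relation.Nullary using (¬_)

-- An event  now + time ≫ @src ⇒ @tgt  with line index `line`, over a
-- contract whose states are Fin S.  The same record is used for pending
-- events  time ≫_line src ⇒ tgt .
record Event (S : ℕ) : Set where
  constructor ev
  field
    time : ℕ
    line : ℕ
    src  : Fin S
    tgt  : Fin S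
open Event public

record Fun (S : ℕ) : Set where
  constructor fun
  field
    from  : Fin S
    fname : ℕ
    body  : List (Event S)
    to    : Fin S
open Fun public

record Contract : Set where
  constructor contract
  field
    nStates : ℕ
    init    : Fin nStates
    funs    : List (Fun nStates)
open Contract public

WellFormed : Contract → Set
WellFormed C = Unique (concatMap (λ f → map line (body f)) (funs C))

IsDI : Contract → Set
IsDI C =
  (∀ {f e} → f ∈ funs C → e ∈ body f → time e ≡ 0)
  × (∀ {f g e} → f ∈ funs C → g ∈ funs C → e ∈ body g → ¬ (from f ≡ src e))

-- Configurations  C(Q, Σ, Ψ)  (clock omitted); Σ = nothing is "_",
-- Σ = just (Ψ' , Q') is  Ψ' ⇒ Q'.  Multisets Ψ are represented by lists.
record Config (S : ℕ) : Set where
  constructor ⟨_,_,_⟩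
  field
    state   : Fin S
    sigma   : Maybe (List (Event S) × Fin S)
    pending : List (Event S)

nored : ∀ {S} → List (Event S) → Fin S → Set
nored Ψ Q = All (λ e → ¬ (time e ≡ 0 × src e ≡ Q)) Ψ

tick : ∀ {S} → List (Event S) → List (Event S)
tick [] = []
tick (ev zero n q q' ∷ Ψ) = tick Ψ
tick (ev (suc k) n q q' ∷ Ψ) = ev k n q q' ∷ tick Ψ

data Step (C : Contract) : Config (nStates C) → Config (nStates C) → Set where
  function : ∀ {f Ψ} → f ∈ funs C → nored Ψ (from f) →
    Step C ⟨ from f , nothing , Ψ ⟩ ⟨ from f , just (body f , to f) , Ψ ⟩
  state-change : ∀ {Q Q' Ψ' Ψ} →
    Step C ⟨ Q , just (Ψ' , Q') , Ψ ⟩ ⟨ Q' , nothing , Ψ' ++ Ψ ⟩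
  -- the matched pending event may sit anywhere in the multiset
  event-match : ∀ {Q Q' n Ψ₁ Ψ₂} →
    Step C ⟨ Q , nothing , Ψ₁ ++ (ev 0 n Q Q' ∷ Ψ₂) ⟩ ⟨ Q , just ([] , Q') , Ψ₁ ++ Ψ₂ ⟩
  tick-step : ∀ {Q Ψ} → nored Ψ Q →
    Step C ⟨ Q , nothing , Ψ ⟩ ⟨ Q , nothing , tick Ψ ⟩

Reachable : (C : Contract) → Fin (nStates C) → Set
Reachable C Q = ∃ λ Ψ → Star (Step C) ⟨ init C , nothing , [] ⟩ ⟨ Q , nothing , Ψ ⟩

{-# OPTIONS --safe #-}
-- In μStipula^DI every pending event has time 0 and an initial state from which no function
-- starts.  Hence calls are always enabled and ticks only discard events, so extra pending
-- events never hurt, and a configuration is faithfully abstracted by its state together with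
-- the number of pending events i ⇒ j for each pair of states.  Reachability of Q thus becomes
-- coverability, decided by backward saturation: starting from (Q, 0), keep adding least
-- predecessors of the points found so far until all of them are covered.  The points added
-- form a bad sequence for the product order, which is almost full (Dickson's lemma), so the
-- saturation stops, and Q is reachable iff the initial point (init, 0) is covered.
module Submission where

open import Defs
open import Level using (0ℓ)
open import Data.Empty using (⊥-elim)
open import Data.Fin using (Fin; zero; suc; _≟_)
import Data.Fin.Properties as Fin
open import Data.List using (List; []; _∷_; _++_; map; filter; tabulate)
open import Data.List.Membership.Propositional using (_∈_; find)
open import Data.List.Membership.Propositional.Properties
  using (∈-∃++; ∈-++⁺ˡ; ∈-++⁺ʳ; ∈-map⁺; ∈-filter⁺; ∈-filter⁻; ∈-tabulate⁺)
open import Data.List.Relation.Unary.Any as Any using (Any; here; there; any?)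
open import Data.List.Relation.Unary.All as All using (All; []; _∷_; all?; lookupAny)
open import Data.List.Relation.Unary.All.Properties using (¬All⇒Any¬; ++⁺; ++⁻; map⁺; tabulate⁺)
open import Data.Maybe using (just; nothing)
open import Data.Nat using (ℕ; zero; suc; _+_; _∸_; _≤_; z≤n; _≤?_)
open import Data.Nat.Properties
  using ( ≤-trans; ≰⇒>; m≤n+m; m≤n+m∸n; m≤n+o⇒m∸n≤o; +-monoʳ-≤; +-monoˡ-≤; +-cancelʳ-≤
        ; +-assoc; +-commutativeSemigroup)
open import Algebra.Properties.CommutativeSemigroup +-commutativeSemigroup using (x∙yz≈xz∙y)
open import Data.Product using (_×_; _,_; ∃; ∃-syntax; proj₁; proj₂)
open import Data.Sum as Sum using (_⊎_; inj₁; inj₂; [_,_]′)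
open import Data.Vec.Functional using (head; tail)
open import Data.Vec.Functional.Relation.Binary.Pointwise using (Pointwise)
open import Function.Base using (_∘_; _on_)
open import Relation.Binary.Core using (Rel; _⇒_)
open import Relation.Binary.Definitions using (Decidable)
open import Relation.Binary.Construct.Intersection using (_∩_)
open import Relation.Binary.Construct.Closure.ReflexiveTransitive using (Star; ε; _◅_)
open import Relation.Binary.PropositionalEquality
  using (_≡_; refl; sym; trans; cong; subst; module ≡-Reasoning)
open import Relation.Nullary using (¬_; Dec; yes; no; contradiction)
open import Relation.Nullary.Decidable using (_×-dec_; map′)

-- Almost-full relations in the inductive form of Vytiniotis, Coquand and Wahlstedt
-- ("Stop when you are almost-full"): every infinite sequence x₀ x₁ … has i < j with R xᵢ xⱼ.
data AlmostFull {A : Set} (R : Rel A 0ℓ) : Set where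
  zt  : (∀ x y → R x y) → AlmostFull R
  sup : (∀ x → AlmostFull (λ y z → R y z ⊎ R x y)) → AlmostFull R

module _ {A : Set} where

  almostFull-mono : {R T : Rel A 0ℓ} → R ⇒ T → AlmostFull R → AlmostFull T
  almostFull-mono R⇒T (zt r)  = zt λ x y → R⇒T (r x y)
  almostFull-mono R⇒T (sup r) = sup λ x → almostFull-mono (Sum.map R⇒T R⇒T) (r x)

  almostFull-on : {B : Set} {R : Rel A 0ℓ} (f : B → A) → AlmostFull R → AlmostFull (R on f)
  almostFull-on f (zt r)  = zt λ x y → r (f x) (f y)
  almostFull-on f (sup r) = sup λ x → almostFull-on f (r (f x))

  private
    both : {R P Q : Set} → R ⊎ P → R ⊎ Q → R ⊎ P × Q
    both (inj₁ r) _        = inj₁ r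
    both (inj₂ _) (inj₁ r) = inj₁ r
    both (inj₂ p) (inj₂ q) = inj₂ (p , q)

    -- The intuitionistic Ramsey theorem almostFull-∩ is proved by induction on both
    -- almost-full proofs through these two generalisations; the inclusions S ⇒ … make
    -- the induction hypotheses applicable to the sup-branches.
    ∪-nullary : {P Q : Set} {R S T : Rel A 0ℓ} →
                AlmostFull S → S ⇒ (λ x y → R x y ⊎ P) →
                AlmostFull T → T ⇒ (λ x y → R x y ⊎ Q) →
                AlmostFull (λ x y → R x y ⊎ P × Q)
    ∪-nullary (zt s) S⇒ t      T⇒ = almostFull-mono (λ t′ → both (S⇒ (s _ _)) (T⇒ t′)) t
    ∪-nullary s      S⇒ (zt t) T⇒ = almostFull-mono (λ s′ → both (S⇒ s′) (T⇒ (t _ _))) s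
    ∪-nullary {P} {Q} {R} (sup s) S⇒ (sup t) T⇒ =
      sup λ x → almostFull-mono regroup (∪-nullary (s x) (shift S⇒) (t x) (shift T⇒))
      where
      shift : ∀ {x} {C : Set} {S : Rel A 0ℓ} → S ⇒ (λ y z → R y z ⊎ C) →
              (λ y z → S y z ⊎ S x y) ⇒ (λ y z → (R y z ⊎ R x y) ⊎ C)
      shift h (inj₁ s) = Sum.map₁ inj₁ (h s)
      shift h (inj₂ s) = Sum.map₁ inj₂ (h s)
      regroup : ∀ {x y z} → (R y z ⊎ R x y) ⊎ P × Q → (R y z ⊎ P × Q) ⊎ (R x y ⊎ P × Q)
      regroup (inj₁ (inj₁ r)) = inj₁ (inj₁ r)
      regroup (inj₁ (inj₂ r)) = inj₂ (inj₁ r)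
      regroup (inj₂ pq)       = inj₁ (inj₂ pq)

    ∪-unary : {U V : A → Set} {R S T : Rel A 0ℓ} →
              AlmostFull S → S ⇒ (λ x y → R x y ⊎ U x) →
              AlmostFull T → T ⇒ (λ x y → R x y ⊎ V x) →
              AlmostFull (λ x y → R x y ⊎ U x × V x)
    ∪-unary (zt s) S⇒ t      T⇒ = almostFull-mono (λ t′ → both (S⇒ (s _ _)) (T⇒ t′)) t
    ∪-unary s      S⇒ (zt t) T⇒ = almostFull-mono (λ s′ → both (S⇒ s′) (T⇒ (t _ _))) s
    ∪-unary {U} {V} {R} (sup s) S⇒ (sup t) T⇒ = sup λ x →
      almostFull-mono regroup
        (∪-nullary (∪-unary (s x) (shift S⇒) (sup t) (keep T⇒)) swap
                   (∪-unary (sup s) (keep S⇒) (t x) (shift T⇒)) swap)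
      where
      module _ {x : A} where
        R′ : Rel A 0ℓ
        R′ y z = R y z ⊎ R x y

        shift : {W : A → Set} {S : Rel A 0ℓ} → S ⇒ (λ y z → R y z ⊎ W y) →
                (λ y z → S y z ⊎ S x y) ⇒ (λ y z → (R′ y z ⊎ W x) ⊎ W y)
        shift h (inj₁ s) = [ (λ r → inj₁ (inj₁ (inj₁ r))) , inj₂ ]′ (h s)
        shift h (inj₂ s) = [ (λ r → inj₁ (inj₁ (inj₂ r))) , (λ w → inj₁ (inj₂ w)) ]′ (h s)

        keep : {W : A → Set} {E : Set} {S : Rel A 0ℓ} → S ⇒ (λ y z → R y z ⊎ W y) →
               S ⇒ (λ y z → (R′ y z ⊎ E) ⊎ W y)
        keep h s = Sum.map₁ (λ r → inj₁ (inj₁ r)) (h s)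

      swap : {P Q E : Set} → (P ⊎ E) ⊎ Q → (P ⊎ Q) ⊎ E
      swap (inj₁ (inj₁ p)) = inj₁ (inj₁ p)
      swap (inj₁ (inj₂ e)) = inj₂ e
      swap (inj₂ q)        = inj₁ (inj₂ q)

      regroup : ∀ {x y z} → ((R y z ⊎ R x y) ⊎ U y × V y) ⊎ U x × V x →
                (R y z ⊎ U y × V y) ⊎ (R x y ⊎ U x × V x)
      regroup (inj₁ (inj₁ (inj₁ r))) = inj₁ (inj₁ r)
      regroup (inj₁ (inj₁ (inj₂ r))) = inj₂ (inj₁ r)
      regroup (inj₁ (inj₂ uv))       = inj₁ (inj₂ uv)
      regroup (inj₂ uv)              = inj₂ (inj₂ uv)

  almostFull-∩ : {R T : Rel A 0ℓ} → AlmostFull R → AlmostFull T → AlmostFull (R ∩ T)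
  almostFull-∩ (zt r) t      = almostFull-mono (λ t′ → r _ _ , t′) t
  almostFull-∩ r      (zt t) = almostFull-mono (λ r′ → r′ , t _ _) r
  almostFull-∩ {R} {T} (sup r) (sup t) = sup λ x →
    ∪-unary (almostFull-∩ (r x) (sup t)) split₁ (almostFull-∩ (sup r) (t x)) split₂
    where
    split₁ : ∀ {x y z} → (R y z ⊎ R x y) × T y z → (R ∩ T) y z ⊎ R x y
    split₁ (inj₁ r , t) = inj₁ (r , t)
    split₁ (inj₂ r , _) = inj₂ r
    split₂ : ∀ {x y z} → R y z × (T y z ⊎ T x y) → (R ∩ T) y z ⊎ T x y
    split₂ (r , inj₁ t) = inj₁ (r , t)
    split₂ (_ , inj₂ t) = inj₂ t

≤-almostFull : AlmostFull _≤_
≤-almostFull = sup above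
  where
  above : ∀ n → AlmostFull (λ y z → y ≤ z ⊎ n ≤ y)
  above zero    = zt λ _ _ → inj₂ z≤n
  above (suc n) = sup λ x → seen (x ≤? n)
    where
    seen : ∀ {x} → Dec (x ≤ n) →
           AlmostFull (λ y z → (y ≤ z ⊎ suc n ≤ y) ⊎ (x ≤ y ⊎ suc n ≤ x))
    seen (no x≰n)  = zt λ _ _ → inj₂ (inj₂ (≰⇒> x≰n))
    seen (yes x≤n) = almostFull-mono (Sum.map inj₁ (λ n≤y → inj₁ (≤-trans x≤n n≤y))) (above n)

pointwise-almostFull : {A : Set} {R : Rel A 0ℓ} → AlmostFull R →
                       ∀ n → AlmostFull (Pointwise R {n})
pointwise-almostFull r zero    = zt λ _ _ ()
pointwise-almostFull r (suc n) =
  almostFull-mono (λ { (r₀ , rs) zero → r₀ ; (r₀ , rs) (suc i) → rs i })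
    (almostFull-∩ (almostFull-on head r) (almostFull-on tail (pointwise-almostFull r n)))

iverson : {P : Set} → Dec P → ℕ
iverson (yes _) = 1
iverson (no _)  = 0

iverson-yes : {P : Set} (p? : Dec P) → P → iverson p? ≡ 1
iverson-yes (yes _) _ = refl
iverson-yes (no ¬p) p = contradiction p ¬p

iverson-pos : {P : Set} (p? : Dec P) → 1 ≤ iverson p? → P
iverson-pos (yes p) _ = p

≡-almostFull : ∀ {n} → AlmostFull (_≡_ {A = Fin n})
≡-almostFull {n} =
  almostFull-mono indicator-≤⇒≡ (almostFull-on indicator (pointwise-almostFull ≤-almostFull n))
  where
  indicator : Fin n → Fin n → ℕ
  indicator a i = iverson (a ≟ i)
  indicator-≤⇒≡ : ∀ {a b} → Pointwise _≤_ (indicator a) (indicator b) → a ≡ b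
  indicator-≤⇒≡ {a} {b} le =
    sym (iverson-pos (b ≟ a) (subst (_≤ indicator b a) (iverson-yes (a ≟ a) refl) (le a)))

module Saturation {A : Set} {_≼_ : Rel A 0ℓ} (_≼?_ : Decidable _≼_)
                  (predecessors : A → List A) where

  Covered : List A → A → Set
  Covered B x = Any (_≼ x) B

  covered? : ∀ B x → Dec (Covered B x)
  covered? B x = any? (_≼? x) B

  Closed : List A → Set
  Closed B = All (λ b → All (Covered B) (predecessors b)) B

  closed? : ∀ B → Dec (Closed B)
  closed? B = all? (λ b → all? (covered? B) (predecessors b)) B

  module _ (P : A → Set) (predecessors-P : ∀ {x} → P x → All P (predecessors x)) where

    private
      Extension : List A → Set
      Extension B = ∃ λ y → P y × ¬ Covered B y

      uncovered-predecessor : ∀ {B} → All P B → ¬ Closed B → Extension B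
      uncovered-predecessor {B} pB ¬closed =
        let pb , ¬all =
              lookupAny pB (¬All⇒Any¬ (λ b → all? (covered? B) (predecessors b)) B ¬closed)
            py , ¬cov = lookupAny (predecessors-P pb) (¬All⇒Any¬ (covered? B) _ ¬all)
        in _ , py , ¬cov

    saturate : AlmostFull _≼_ → ∀ {x₀} → P x₀ → ∃ λ B → All P B × Covered B x₀ × Closed B
    saturate af {x₀} p₀ = grow [] af inj₁
      where
      Basis : List A → Set
      Basis B = All P B × Covered B x₀ × Closed B

      next : ∀ B → All P B → Basis B ⊎ Extension B
      next B pB with covered? B x₀
      ... | no ¬c = inj₂ (x₀ , p₀ , ¬c)
      ... | yes c with closed? B
      ...   | yes closed = inj₁ (pB , c , closed)
      ...   | no ¬closed = inj₂ (uncovered-predecessor pB ¬closed)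

      -- Each point added is uncovered by the earlier ones, so by the invariant R holds between
      -- added points only where ≼ does; each addition consumes one sup of the proof.
      grow : ∀ {B} → All P B → {R : Rel A 0ℓ} → AlmostFull R →
             R ⇒ (λ y z → y ≼ z ⊎ Covered B y) → ∃ Basis
      grow {B} pB af inv with next B pB
      ... | inj₁ basis = B , basis
      grow {B} pB (sup r) inv | inj₂ (y , py , ¬c) = grow (py ∷ pB) (r y) inv′
        where
        inv′ : (λ y′ z → _ ⊎ _) ⇒ (λ y′ z → y′ ≼ z ⊎ Covered (y ∷ B) y′)
        inv′ (inj₁ r) = Sum.map₂ there (inv r)
        inv′ (inj₂ r) = [ inj₂ ∘ here , ⊥-elim ∘ ¬c ]′ (inv r)
      grow {B} pB (zt r) inv | inj₂ (y , py , ¬c) with next (y ∷ B) (py ∷ pB)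
      ... | inj₁ basis = _ , basis
      ... | inj₂ (z , _ , ¬c′) = ⊥-elim ([ ¬c′ ∘ here , ¬c ]′ (inv (r y z)))

Counts : ℕ → Set
Counts S = Fin S → Fin S → ℕ

module _ {S : ℕ} where

  infix  4 _≤ᶜ_
  infixl 6 _+ᶜ_ _∸ᶜ_

  _≤ᶜ_ : Counts S → Counts S → Set
  _≤ᶜ_ = Pointwise (Pointwise _≤_)

  _+ᶜ_ _∸ᶜ_ : Counts S → Counts S → Counts S
  (v +ᶜ w) i j = v i j + w i j
  (v ∸ᶜ w) i j = v i j ∸ w i j

  unit : Fin S → Fin S → Counts S
  unit a b i j = iverson (a ≟ i ×-dec b ≟ j)

  -- Times and line indices are forgotten: in DI every pending event has time 0.
  count : List (Event S) → Counts S
  count []      _ _ = 0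
  count (e ∷ Ψ)     = unit (src e) (tgt e) +ᶜ count Ψ

  unit-self : ∀ a b → unit a b a b ≡ 1
  unit-self a b = iverson-yes (a ≟ a ×-dec b ≟ b) (refl , refl)

  +ᶜ-unit-pos : ∀ {v w} a b → v +ᶜ unit a b ≤ᶜ w → 1 ≤ w a b
  +ᶜ-unit-pos {v} {w} a b le =
    ≤-trans (m≤n+m 1 (v a b)) (subst (λ k → v a b + k ≤ w a b) (unit-self a b) (le a b))

  count-++ : ∀ Ψ₁ Ψ₂ i j → count (Ψ₁ ++ Ψ₂) i j ≡ count Ψ₁ i j + count Ψ₂ i j
  count-++ []       Ψ₂ i j = refl
  count-++ (e ∷ Ψ₁) Ψ₂ i j =
    trans (cong (unit (src e) (tgt e) i j +_) (count-++ Ψ₁ Ψ₂ i j))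
          (sym (+-assoc (unit (src e) (tgt e) i j) _ _))

  count-middle : ∀ Ψ₁ e Ψ₂ i j →
                 count (Ψ₁ ++ e ∷ Ψ₂) i j ≡ count (Ψ₁ ++ Ψ₂) i j + unit (src e) (tgt e) i j
  count-middle Ψ₁ e Ψ₂ i j = begin
    count (Ψ₁ ++ e ∷ Ψ₂) i j          ≡⟨ count-++ Ψ₁ (e ∷ Ψ₂) i j ⟩
    count Ψ₁ i j + (u + count Ψ₂ i j) ≡⟨ x∙yz≈xz∙y (count Ψ₁ i j) u _ ⟩
    count Ψ₁ i j + count Ψ₂ i j + u   ≡⟨ cong (_+ u) (sym (count-++ Ψ₁ Ψ₂ i j)) ⟩
    count (Ψ₁ ++ Ψ₂) i j + u          ∎
    where
    open ≡-Reasoning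
    u : ℕ
    u = unit (src e) (tgt e) i j

  ≤ᶜ-count-++⁺ : ∀ Φ {Ψ v} → v ∸ᶜ count Φ ≤ᶜ count Ψ → v ≤ᶜ count (Φ ++ Ψ)
  ≤ᶜ-count-++⁺ Φ {Ψ} {v} le i j = subst (v i j ≤_) (sym (count-++ Φ Ψ i j))
    (≤-trans (m≤n+m∸n (v i j) (count Φ i j)) (+-monoʳ-≤ (count Φ i j) (le i j)))

  ≤ᶜ-count-++⁻ : ∀ Φ {Ψ v} → v ≤ᶜ count (Φ ++ Ψ) → v ∸ᶜ count Φ ≤ᶜ count Ψ
  ≤ᶜ-count-++⁻ Φ {Ψ} {v} le i j =
    m≤n+o⇒m∸n≤o (v i j) (count Φ i j) (subst (v i j ≤_) (count-++ Φ Ψ i j) (le i j))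

  ≤ᶜ-count-insert⁺ : ∀ Ψ₁ e {Ψ₂ v} → v ≤ᶜ count (Ψ₁ ++ Ψ₂) →
                     v +ᶜ unit (src e) (tgt e) ≤ᶜ count (Ψ₁ ++ e ∷ Ψ₂)
  ≤ᶜ-count-insert⁺ Ψ₁ e {Ψ₂} {v} le i j = subst (v i j + unit (src e) (tgt e) i j ≤_)
    (sym (count-middle Ψ₁ e Ψ₂ i j)) (+-monoˡ-≤ (unit (src e) (tgt e) i j) (le i j))

  ≤ᶜ-count-insert⁻ : ∀ Ψ₁ e {Ψ₂ v} → v +ᶜ unit (src e) (tgt e) ≤ᶜ count (Ψ₁ ++ e ∷ Ψ₂) →
                     v ≤ᶜ count (Ψ₁ ++ Ψ₂)
  ≤ᶜ-count-insert⁻ Ψ₁ e {Ψ₂} {v} le i j = +-cancelʳ-≤ (unit (src e) (tgt e) i j) (v i j) _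
    (subst (v i j + unit (src e) (tgt e) i j ≤_) (count-middle Ψ₁ e Ψ₂ i j) (le i j))

  count-tick : ∀ Ψ → count (tick Ψ) ≤ᶜ count Ψ
  count-tick []                     i j = z≤n
  count-tick (ev zero    _ _ _ ∷ Ψ) i j = ≤-trans (count-tick Ψ i j) (m≤n+m _ _)
  count-tick (ev (suc _) _ a b ∷ Ψ) i j = +-monoʳ-≤ (unit a b i j) (count-tick Ψ i j)

  count-pos : ∀ Ψ {a b} → 1 ≤ count Ψ a b → Any (λ e → src e ≡ a × tgt e ≡ b) Ψ
  count-pos (e ∷ Ψ) {a} {b} pos with src e ≟ a ×-dec tgt e ≟ b
  ... | yes e≡ab = here e≡ab
  ... | no _     = there (count-pos Ψ pos)

module Backward (C : Contract) (di : IsDI C) (target : Fin (nStates C)) where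

  S : ℕ
  S = nStates C

  _⟶*_ : Config S → Config S → Set
  _⟶*_ = Star (Step C)

  DIEvent : Event S → Set
  DIEvent e = time e ≡ 0 × (∀ {f} → f ∈ funs C → ¬ from f ≡ src e)

  body-DIEvent : ∀ {f e} → f ∈ funs C → e ∈ body f → DIEvent e
  body-DIEvent f∈ e∈ = proj₁ di f∈ e∈ , λ g∈ → proj₂ di g∈ f∈ e∈

  Point : Set
  Point = Fin S × Counts S

  _≼_ : Rel Point 0ℓ
  _≼_ = (_≡_ on proj₁) ∩ (_≤ᶜ_ on proj₂)

  _≼?_ : Decidable _≼_
  (q , v) ≼? (q′ , w) = (q ≟ q′) ×-dec Fin.all? (λ i → Fin.all? (λ j → v i j ≤? w i j))

  ≼-trans : ∀ {x y z} → x ≼ y → y ≼ z → x ≼ z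
  ≼-trans (refl , v≤w) (refl , w≤u) = refl , λ i j → ≤-trans (v≤w i j) (w≤u i j)

  ≼-almostFull : AlmostFull _≼_
  ≼-almostFull = almostFull-∩ (almostFull-on proj₁ ≡-almostFull)
    (almostFull-on proj₂ (pointwise-almostFull (pointwise-almostFull ≤-almostFull S) S))

  Reach : Fin S → List (Event S) → Set
  Reach q Ψ = ∃ λ Ψ′ → ⟨ q , nothing , Ψ ⟩ ⟶* ⟨ target , nothing , Ψ′ ⟩

  UpReaches : Point → Set
  UpReaches (q , v) = ∀ {Ψ} → All DIEvent Ψ → v ≤ᶜ count Ψ → Reach q Ψ

  -- For each way of entering q (a call of a function ending in q, or the match of an event
  -- a ⇒ q), the least point from which that step leads above (q , v).
  predecessors : Point → List Point
  predecessors (q , v) =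
    map (λ f → from f , v ∸ᶜ count (body f)) (filter (λ f → to f ≟ q) (funs C))
    ++ tabulate (λ a → a , v +ᶜ unit a q)

  call-UpReaches : ∀ {f q v} → f ∈ funs C → to f ≡ q → UpReaches (q , v) →
                   UpReaches (from f , v ∸ᶜ count (body f))
  call-UpReaches {f} f∈ refl up {Ψ} dΨ le =
    let Ψ′ , run = up (++⁺ (All.tabulate (body-DIEvent f∈)) dΨ) (≤ᶜ-count-++⁺ (body f) le)
    in Ψ′ , function f∈ enabled ◅ state-change ◅ run
    where
    enabled : nored Ψ (from f)
    enabled = All.map (λ (_ , notFun) (_ , src≡) → notFun f∈ (sym src≡)) dΨ

  pending-split : ∀ {Ψ a q} → All DIEvent Ψ → 1 ≤ count Ψ a q →
                  ∃[ Ψ₁ ] ∃[ n ] ∃[ Ψ₂ ] Ψ ≡ Ψ₁ ++ ev 0 n a q ∷ Ψ₂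
  pending-split {Ψ} dΨ pos
    with ev _ n _ _ , e∈ , refl , refl ← find (count-pos Ψ pos)
    with refl , _ ← All.lookup dΨ e∈
    with Ψ₁ , Ψ₂ , Ψ≡ ← ∈-∃++ e∈
    = Ψ₁ , n , Ψ₂ , Ψ≡

  match-UpReaches : ∀ {a q v} → UpReaches (q , v) → UpReaches (a , v +ᶜ unit a q)
  match-UpReaches {a} {q} {v} up {Ψ} dΨ le
    with Ψ₁ , n , Ψ₂ , refl ← pending-split dΨ (+ᶜ-unit-pos a q le)
    with d₁ , _ ∷ d₂ ← ++⁻ Ψ₁ dΨ
    with Ψ′ , run ← up (++⁺ d₁ d₂) (≤ᶜ-count-insert⁻ Ψ₁ (ev 0 n a q) le)
    = Ψ′ , event-match ◅ state-change ◅ run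

  predecessors-UpReaches : ∀ {x} → UpReaches x → All UpReaches (predecessors x)
  predecessors-UpReaches {q , v} up =
    ++⁺ (map⁺ (All.tabulate call)) (tabulate⁺ λ _ → match-UpReaches up)
    where
    call : ∀ {f} → f ∈ filter (λ f → to f ≟ q) (funs C) →
           UpReaches (from f , v ∸ᶜ count (body f))
    call f∈ = let f∈C , to≡q = ∈-filter⁻ (λ f → to f ≟ q) f∈ in call-UpReaches f∈C to≡q up

  open Saturation _≼?_ predecessors

  -- A configuration in the middle of a state change is abstracted by its outcome.
  point : Config S → Point
  point ⟨ q , nothing , Ψ ⟩        = q , count Ψ
  point ⟨ _ , just (Ψ′ , q′) , Ψ ⟩ = q′ , count (Ψ′ ++ Ψ)

  covered-upward : ∀ {B x y} → Covered B x → x ≼ y → Covered B y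
  covered-upward cov x≼y = Any.map (λ b≼x → ≼-trans b≼x x≼y) cov

  predecessor-covered : ∀ {B b y} → Closed B → b ∈ B → y ∈ predecessors b → Covered B y
  predecessor-covered closed b∈ y∈ = All.lookup (All.lookup closed b∈) y∈

  step-covered : ∀ {B c c′} → Closed B → Step C c c′ → Covered B (point c′) → Covered B (point c)
  step-covered closed (function {f} {Ψ} f∈ _) cov
    with (_ , v) , b∈ , (refl , le) ← find cov
    = covered-upward (predecessor-covered closed b∈ (∈-++⁺ˡ (∈-map⁺ _ (∈-filter⁺ _ f∈ refl))))
        (refl , ≤ᶜ-count-++⁻ (body f) le)
  step-covered closed state-change cov = cov
  step-covered closed (event-match {Q} {Q′} {n} {Ψ₁} {Ψ₂}) cov
    with (_ , v) , b∈ , (refl , le) ← find cov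
    = covered-upward (predecessor-covered closed b∈ (∈-++⁺ʳ _ (∈-tabulate⁺ Q)))
        (refl , ≤ᶜ-count-insert⁺ Ψ₁ (ev 0 n Q Q′) le)
  step-covered closed (tick-step {Ψ = Ψ} _) cov = covered-upward cov (refl , count-tick Ψ)

  run-covered : ∀ {B c c′} → Closed B → c ⟶* c′ → Covered B (point c′) → Covered B (point c)
  run-covered closed ε            cov = cov
  run-covered closed (step ◅ run) cov = step-covered closed step (run-covered closed run cov)

  reaches⇒covered : ∀ {B q Ψ} → Closed B → Covered B (target , count []) →
                    Reach q Ψ → Covered B (q , count Ψ)
  reaches⇒covered closed cov (_ , run) =
    run-covered closed run (covered-upward cov (refl , λ _ _ → z≤n))

  covered⇒reaches : ∀ {B q Ψ} → All UpReaches B → Covered B (q , count Ψ) →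
                    All DIEvent Ψ → Reach q Ψ
  covered⇒reaches ups cov dΨ with _ , b∈ , (refl , le) ← find cov = All.lookup ups b∈ dΨ le

  reachable? : Dec (Reachable C target)
  reachable? =
    let B , ups , cov , closed =
          saturate UpReaches predecessors-UpReaches ≼-almostFull (λ _ _ → _ , ε)
    in map′ (λ c → covered⇒reaches ups c []) (reaches⇒covered closed cov)
            (covered? B (init C , count []))

corollary1 : (C : Contract) → WellFormed C → IsDI C → (Q : Fin (nStates C)) → Dec (Reachable C Q)
-- Line indices never influence a transition, so well-formedness is not needed.
corollary1 C _ di Q = reachable?
  where open Backward C di Q
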